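{- Let $n,r\in\mathbb N$ with $n\geq r$ and $r$ dividing $n$. Let $G$ be a $K_{r+1}$-free graph on $n$ vertices whose degree sequence $d_1\leq\dots\leq d_n$ satisfies $d_{n/r}\geq (r-1)n/r$. Then $G$ is a subgraph of $T(n,r)$ (i.e. $G$ is isomorphic to a subgraph of $T(n,r)$ on the same number of vertices).
   Context: $T(n,r)$ denotes the Turán graph: the complete $r$-partite graph on $n$ vertices in which each vertex class has size $\lfloor n/r\rfloor$ or $\lceil n/r\rceil$. The degree sequence $d_1\le\dots\le d_n$ lists the vertex degrees of $G$ in non-decreasing order. -}

module Defs where

open import Data.Nat using (ℕ; zero; suc; _+_; _∸_; _*_; _/_; _≥_; NonZero)
open import Data.Nat.Properties using (≤-decTotalOrder)
open import Data.Nat.DivMod using (_%_)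
open import Data.Bool using (Bool; true; false; if_then_else_)
open import Data.Fin using (Fin; toℕ)
open import Data.List using (List; []; _∷_; map; allFin)
open import Data.Nat.ListAction using (sum)
open import Data.Product using (Σ; _×_)
open import Relation.Binary.PropositionalEquality using (_≡_; _≢_)
open import Relation.Nullary using (¬_)
open import Function.Definitions using (Injective)
import Data.List.Sort

record Graph (n : ℕ) : Set where
  field
    adj     : Fin n → Fin n → Bool
    sym     : ∀ u v → adj u v ≡ adj v u
    irrefl  : ∀ v → adj v v ≡ false
open Graph public

degree : ∀ {n} → Graph n → Fin n → ℕ
degree {n} G v = sum (map (λ u → if adj G v u then 1 else 0) (allFin n))

open Data.List.Sort ≤-decTotalOrder using (sort)

degreeSeq : ∀ {n} → Graph n → List ℕ
degreeSeq {n} G = sort (map (degree G) (allFin n))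

-- 1-indexed access: nth k xs = x_k (0 if out of range; never used out of range)
nth : ℕ → List ℕ → ℕ
nth _ [] = 0
nth (suc zero) (x ∷ xs) = x
nth zero (x ∷ xs) = 0
nth (suc (suc k)) (x ∷ xs) = nth (suc k) xs

ContainsK : ∀ {n} → ℕ → Graph n → Set
ContainsK {n} m G =
  Σ (Fin m → Fin n) λ f → Injective _≡_ _≡_ f ×
    (∀ i j → i ≢ j → adj G (f i) (f j) ≡ true)

-- Turán graph T(n,r) for r ∣ n: class of vertex i is (i mod r), giving r classes
-- each of size n/r; two vertices are adjacent iff they lie in different classes.
turanAdj : (n r : ℕ) → .{{NonZero r}} → Fin n → Fin n → Bool
turanAdj n r u v with (toℕ u % r) Data.Nat.≟ (toℕ v % r)
... | Relation.Nullary.yes _ = false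
... | Relation.Nullary.no _ = true

IsSubgraphOf : ∀ {n} → Graph n → (Fin n → Fin n → Bool) → Set
IsSubgraphOf {n} G H =
  Σ (Fin n → Fin n) λ f → Injective _≡_ _≡_ f ×
    (∀ u v → adj G u v ≡ true → H (f u) (f v) ≡ true)

-- Let n = m·r. Fewer than m vertices have degree below (r−1)·m, and every other ("high") vertex is
-- non-adjacent to at most m vertices, itself included. Hence j < r high vertices leave at most
-- j·m + (m − 1) < n vertices that are low or miss one of them, so they have a common high neighbour;
-- greedily this gives an r-clique v of high vertices. Since G has no K_{r+1}, every vertex u misses some
-- v a, and the misses total at most r·m = n, so u misses exactly one v a: call a the part of u. Adjacent
-- u, w in the same part a are impossible, since replacing v a by w gives an r-clique inside the
-- neighbourhood of u. Part a lies among the at most m non-neighbours of v a, so mapping u to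
-- rank-in-its-part·r + part embeds G into T(n,r).

module Submission where

open import Defs hiding (sym)
open import Data.Nat using (ℕ; zero; suc; _+_; _∸_; _*_; _/_; _≤_; _<_; z≤n; s≤s; _≤?_; NonZero)
open import Data.Nat.Properties
open import Data.Nat.DivMod using (_%_; m/n*n≡m; m≥n⇒m/n>0; *-/-assoc; %-remove-+ˡ; m<n⇒m%n≡m)
open import Data.Nat.Divisibility using (_∣_; m∣m*n)
import Data.Nat.ListAction as List
open import Data.Nat.ListAction.Properties using (sum-↭)
open import Algebra.Properties.CommutativeMonoid.Sum +-0-commutativeMonoid
  using (sum; ∑-distrib-+; ∑-comm; sum-cong-≗; sum-remove)
open import Data.Bool using (Bool; true; false; not; if_then_else_)
import Data.Bool.Properties as Bool
open import Data.Fin as Fin using (Fin; zero; suc; toℕ; fromℕ<; cast; combine; punchOut)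
open import Data.Fin.Properties
  using (any?; all?; ¬∀⟶∃¬; punchIn-punchOut; toℕ<n; toℕ-fromℕ<; toℕ-cast; toℕ-combine;
         toℕ-injective; combine-injective)
  renaming (_≟_ to _≟ᶠ_; _<?_ to _<ᶠ?_; <-irrefl to <ᶠ-irrefl; <-trans to <ᶠ-trans; <-cmp to <ᶠ-cmp)
open import Data.Vec.Functional as Vector using (removeAt; updateAt)
open import Data.Vec.Functional.Properties using (updateAt-updates; updateAt-minimal)
open import Data.List using (List; []; _∷_; map; allFin; tabulate)
open import Data.List.Properties using (map-tabulate; map-∘)
open import Data.List.Relation.Unary.Linked using (Linked; []; [-]; _∷_)
open import Data.List.Relation.Binary.Permutation.Propositional.Properties using (map⁺)
open import Data.List.Sort ≤-decTotalOrder using (sort; sort-↭; sort-↗)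
open import Data.Product using (Σ; ∃; _×_; _,_; proj₁; proj₂)
open import Function using (_∘_; id; const)
open import Function.Definitions using (Injective)
open import Relation.Binary.Definitions using (tri<; tri≈; tri>)
open import Relation.Binary.PropositionalEquality
open import Relation.Nullary using (¬_; Dec; yes; no; does; contradiction)
open import Relation.Nullary.Decidable using (¬?; _×-dec_; dec-true; dec-false)
open import Relation.Unary using (Pred; Decidable; _⊆_)

private
  variable
    n j : ℕ

-- Finite sums

∑-mono-≤ : {f g : Fin n → ℕ} → (∀ i → f i ≤ g i) → sum f ≤ sum g
∑-mono-≤ {zero}  f≤g = z≤n
∑-mono-≤ {suc n} f≤g = +-mono-≤ (f≤g zero) (∑-mono-≤ (f≤g ∘ suc))

∑-mono-< : {f g : Fin n → ℕ} → (∀ i → f i ≤ g i) → ∀ i → f i < g i → sum f < sum g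
∑-mono-< {suc n} f≤g zero    fi<gi = +-mono-<-≤ fi<gi (∑-mono-≤ (f≤g ∘ suc))
∑-mono-< {suc n} f≤g (suc i) fi<gi = +-mono-≤-< (f≤g zero) (∑-mono-< (f≤g ∘ suc) i fi<gi)

∑-const : ∀ n c → sum {n} (const c) ≡ n * c
∑-const zero    c = refl
∑-const (suc n) c = cong (c +_) (∑-const n c)

∑-const-1 : ∀ n → sum {n} (const 1) ≡ n
∑-const-1 n = trans (∑-const n 1) (*-identityʳ n)

∑-elem : (f : Fin n → ℕ) (i : Fin n) → f i ≤ sum f
∑-elem {suc n} f i = ≤-trans (m≤m+n (f i) _) (≤-reflexive (sym (sum-remove f)))

∑-pair : (f : Fin n → ℕ) {i j : Fin n} → i ≢ j → f i + f j ≤ sum f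
∑-pair {suc n} f {i} {j} i≢j = begin
  f i + f j                                ≡⟨ cong (λ k → f i + f k) (punchIn-punchOut i≢j) ⟨
  f i + removeAt f i (punchOut i≢j)        ≤⟨ +-monoʳ-≤ (f i) (∑-elem (removeAt f i) (punchOut i≢j)) ⟩
  f i + sum (removeAt f i)                 ≡⟨ sum-remove f ⟨
  sum f                                    ∎
  where open ≤-Reasoning

∑-list : (f : Fin n → ℕ) → List.sum (map f (allFin n)) ≡ sum f
∑-list {n} f = trans (cong List.sum (map-tabulate id f)) (tabulate-sum f)
  where
  tabulate-sum : ∀ {n} (f : Fin n → ℕ) → List.sum (tabulate f) ≡ sum f
  tabulate-sum {zero}  f = refl
  tabulate-sum {suc n} f = cong (f zero +_) (tabulate-sum (f ∘ suc))

∑≤n⇒≤1 : (f : Fin n → ℕ) → (∀ i → 1 ≤ f i) → sum f ≤ n → ∀ i → f i ≤ 1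
∑≤n⇒≤1 {n} f 1≤f ∑f≤n i with f i ≤? 1
... | yes fi≤1 = fi≤1
... | no  fi≰1 = contradiction ∑f≤n (<⇒≱ (begin-strict
  n                  ≡⟨ ∑-const-1 n ⟨
  sum {n} (const 1)  <⟨ ∑-mono-< 1≤f i (≰⇒> fi≰1) ⟩
  sum f              ∎))
  where open ≤-Reasoning

∑<n⇒∃ : ∀ {p} {P : Pred (Fin n) p} → Decidable P → (f : Fin n → ℕ) →
        (∀ i → ¬ P i → 1 ≤ f i) → sum f < n → ∃ P
∑<n⇒∃ {n} P? f ¬P⇒1≤f ∑f<n with any? P?
... | yes ∃P = ∃P
... | no ¬∃P = contradiction ∑f<n (≤⇒≯ (begin
  n                  ≡⟨ ∑-const-1 n ⟨
  sum {n} (const 1)  ≤⟨ ∑-mono-≤ (λ i → ¬P⇒1≤f i (¬∃P ∘ (i ,_))) ⟩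
  sum f              ∎))
  where open ≤-Reasoning

-- Counting

𝟙 : Bool → ℕ
𝟙 b = if b then 1 else 0

count : ∀ {p} {P : Pred (Fin n) p} → Decidable P → ℕ
count P? = sum (λ i → 𝟙 (does (P? i)))

module _ {p q} {P : Pred (Fin n) p} {Q : Pred (Fin n) q} (P? : Decidable P) (Q? : Decidable Q) where

  𝟙-mono : P ⊆ Q → ∀ i → 𝟙 (does (P? i)) ≤ 𝟙 (does (Q? i))
  𝟙-mono P⊆Q i with P? i | Q? i
  ... | no  _  | _      = z≤n
  ... | yes _  | yes _  = ≤-refl
  ... | yes pi | no ¬qi = contradiction (P⊆Q pi) ¬qi

  count-mono : P ⊆ Q → count P? ≤ count Q?
  count-mono P⊆Q = ∑-mono-≤ (𝟙-mono P⊆Q)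

  count-mono-< : P ⊆ Q → ∀ {i} → Q i → ¬ P i → count P? < count Q?
  count-mono-< P⊆Q {i} qi ¬pi = ∑-mono-< (𝟙-mono P⊆Q) i strict
    where
    strict : 𝟙 (does (P? i)) < 𝟙 (does (Q? i))
    strict rewrite dec-false (P? i) ¬pi | dec-true (Q? i) qi = ≤-refl

module _ {p} {P : Pred (Fin n) p} (P? : Decidable P) where

  count-pos : ∀ {i} → P i → 1 ≤ count P?
  count-pos {i} pi = ≤-trans (≤-reflexive (cong 𝟙 (sym (dec-true (P? i) pi)))) (∑-elem _ i)

  count≤1⇒unique : count P? ≤ 1 → ∀ {i j} → P i → P j → i ≡ j
  count≤1⇒unique count≤1 {i} {j} pi pj with i ≟ᶠ j
  ... | yes i≡j = i≡j
  ... | no  i≢j = contradiction (≤-trans (∑-pair _ i≢j) count≤1) (<⇒≱ two≤)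
    where
    two≤ : 1 < 𝟙 (does (P? i)) + 𝟙 (does (P? j))
    two≤ rewrite dec-true (P? i) pi | dec-true (P? j) pj = ≤-refl

  count+count-∁ : count P? + count (¬? ∘ P?) ≡ n
  count+count-∁ = begin
    count P? + count (¬? ∘ P?)                            ≡⟨ ∑-distrib-+ {n} _ _ ⟨
    sum (λ i → 𝟙 (does (P? i)) + 𝟙 (not (does (P? i))))  ≡⟨ sum-cong-≗ (λ i → 𝟙+𝟙-not (does (P? i))) ⟩
    sum {n} (const 1)                                     ≡⟨ ∑-const-1 n ⟩
    n                                                     ∎
    where
    open ≡-Reasoning
    𝟙+𝟙-not : ∀ b → 𝟙 b + 𝟙 (not b) ≡ 1
    𝟙+𝟙-not true  = refl
    𝟙+𝟙-not false = refl

-- Sorted degree sequences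

countBelow : ℕ → List ℕ → ℕ
countBelow D xs = List.sum (map (λ x → 𝟙 (does (¬? (D ≤? x)))) xs)

countBelow-sorted-≥head : ∀ {D y ys} → Linked _≤_ (y ∷ ys) → D ≤ y → countBelow D (y ∷ ys) ≡ 0
countBelow-sorted-≥head {D} {y} {ys} sorted D≤y rewrite dec-true (D ≤? y) D≤y = rest sorted
  where
  rest : Linked _≤_ (y ∷ ys) → countBelow D ys ≡ 0
  rest [-]            = refl
  rest (y≤z ∷ sorted) = countBelow-sorted-≥head sorted (≤-trans D≤y y≤z)

countBelow-sorted : ∀ {D m xs} → Linked _≤_ xs → D ≤ nth m xs → 1 ≤ m → countBelow D xs < m
countBelow-sorted {xs = []}     _      _   1≤m = 1≤m
countBelow-sorted {D} {suc zero} {y ∷ ys} sorted D≤y _ =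
  s≤s (≤-reflexive (countBelow-sorted-≥head sorted D≤y))
countBelow-sorted {D} {suc (suc m)} {y ∷ ys} sorted D≤x _ =
  ≤-trans (≤-reflexive (sym (+-suc _ _)))
    (+-mono-≤ (𝟙≤1 (not (does (D ≤? y)))) (countBelow-sorted (tail sorted) D≤x (s≤s z≤n)))
  where
  𝟙≤1 : ∀ b → 𝟙 b ≤ 1
  𝟙≤1 true  = ≤-refl
  𝟙≤1 false = z≤n
  tail : Linked _≤_ (y ∷ ys) → Linked _≤_ ys
  tail [-]        = []
  tail (_ ∷ rest) = rest

-- Graphs

updateAt-const-∀ : ∀ {p} {P : Pred (Fin n) p} (v : Fin j → Fin n) i {w} →
                   P w → (∀ b → b ≢ i → P (v b)) → ∀ b → P (updateAt v i (const w) b)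
updateAt-const-∀ {P = P} v i pw pv b with b ≟ᶠ i
... | yes refl = subst P (sym (updateAt-updates i v)) pw
... | no  b≢i  = subst P (sym (updateAt-minimal b i v b≢i)) (pv b b≢i)

module _ (G : Graph n) where

  Adjacent : Fin n → Fin n → Set
  Adjacent u v = adj G u v ≡ true

  adjacent? : ∀ u v → Dec (Adjacent u v)
  adjacent? u v = adj G u v Bool.≟ true

  Adjacent-sym : ∀ {u v} → Adjacent u v → Adjacent v u
  Adjacent-sym {u} {v} = trans (Graph.sym G v u)

  Adjacent-irrefl : ∀ {u} → ¬ Adjacent u u
  Adjacent-irrefl {u} u~u with () ← trans (sym u~u) (irrefl G u)

  IsClique : (Fin j → Fin n) → Set
  IsClique v = ∀ a b → a ≢ b → Adjacent (v a) (v b)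

  clique⇒ContainsK : {v : Fin j → Fin n} → IsClique v → ContainsK j G
  clique⇒ContainsK {v = v} clique = v , injective , clique
    where
    injective : Injective _≡_ _≡_ v
    injective {a} {b} va≡vb with a ≟ᶠ b
    ... | yes a≡b = a≡b
    ... | no  a≢b = contradiction (subst (Adjacent (v a)) (sym va≡vb) (clique a b a≢b)) Adjacent-irrefl

  ∷-clique : ∀ {u} {v : Fin j → Fin n} → IsClique v → (∀ a → Adjacent (v a) u) →
             IsClique (u Vector.∷ v)
  ∷-clique clique v~u zero    zero    0≢0 = contradiction refl 0≢0
  ∷-clique clique v~u zero    (suc b) _   = Adjacent-sym (v~u b)
  ∷-clique clique v~u (suc a) zero    _   = v~u a
  ∷-clique clique v~u (suc a) (suc b) a≢b = clique a b (a≢b ∘ cong suc)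

  updateAt-clique : ∀ {v : Fin j → Fin n} {i w} → IsClique v → (∀ b → b ≢ i → Adjacent (v b) w) →
                    IsClique (updateAt v i (const w))
  updateAt-clique {v = v} {i} {w} clique v~w a b a≢b with a ≟ᶠ i | b ≟ᶠ i
  ... | yes refl | yes refl = contradiction refl a≢b
  ... | yes refl | no  b≢i  rewrite updateAt-updates i {const w} v | updateAt-minimal b i {const w} v b≢i =
    Adjacent-sym (v~w b b≢i)
  ... | no  a≢i  | yes refl rewrite updateAt-updates i {const w} v | updateAt-minimal a i {const w} v a≢i =
    v~w a a≢i
  ... | no  a≢i  | no  b≢i
    rewrite updateAt-minimal a i {const w} v a≢i | updateAt-minimal b i {const w} v b≢i = clique a b a≢b

  degree≡count : ∀ v → degree G v ≡ count (adjacent? v)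
  degree≡count v = trans (∑-list (λ u → if adj G v u then 1 else 0))
                         (sum-cong-≗ (λ u → indicator (adj G v u)))
    where
    indicator : ∀ b → (if b then 1 else 0) ≡ 𝟙 (does (b Bool.≟ true))
    indicator true  = refl
    indicator false = refl

  degree+nonNeighbours≡n : ∀ v → degree G v + count (¬? ∘ adjacent? v) ≡ n
  degree+nonNeighbours≡n v =
    trans (cong (_+ count (¬? ∘ adjacent? v)) (degree≡count v)) (count+count-∁ (adjacent? v))

  countBelow-degreeSeq : ∀ D → count (λ u → ¬? (D ≤? degree G u)) ≡ countBelow D (degreeSeq G)
  countBelow-degreeSeq D = begin
    count (λ u → ¬? (D ≤? degree G u))            ≡⟨ ∑-list (below ∘ degree G) ⟨
    List.sum (map (below ∘ degree G) (allFin n))  ≡⟨ cong List.sum (map-∘ (allFin n)) ⟩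
    countBelow D degrees                          ≡⟨ sum-↭ (map⁺ below (sort-↭ degrees)) ⟨
    countBelow D (sort degrees)                   ∎
    where
    open ≡-Reasoning
    degrees : List ℕ
    degrees = map (degree G) (allFin n)
    below : ℕ → ℕ
    below x = 𝟙 (does (¬? (D ≤? x)))

-- Subgraphs of the Turán graph

turanAdj-≢ : ∀ n r .{{_ : NonZero r}} {x y : Fin n} → toℕ x % r ≢ toℕ y % r →
             turanAdj n r x y ≡ true
turanAdj-≢ n r {x} {y} x≢y with toℕ x % r Data.Nat.≟ toℕ y % r
... | yes x≡y = contradiction x≡y x≢y
... | no  _   = refl

module _ {n r m : ℕ} .{{_ : NonZero r}} (n≡m*r : n ≡ m * r) (part : Fin n → Fin r)
         (partSize≤m : ∀ c → count (λ u → part u ≟ᶠ c) ≤ m) where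

  EarlierInPart : Fin n → Fin n → Set
  EarlierInPart u w = w Fin.< u × part w ≡ part u

  earlierInPart? : ∀ u → Decidable (EarlierInPart u)
  earlierInPart? u w = (w <ᶠ? u) ×-dec (part w ≟ᶠ part u)

  rank : Fin n → ℕ
  rank u = count (earlierInPart? u)

  rank<m : ∀ u → rank u < m
  rank<m u = <-≤-trans
    (count-mono-< (earlierInPart? u) (λ w → part w ≟ᶠ part u) proj₂ refl (<ᶠ-irrefl refl ∘ proj₁))
    (partSize≤m (part u))

  rank-mono : ∀ {u w} → u Fin.< w → part u ≡ part w → rank u < rank w
  rank-mono {u} {w} u<w pu≡pw = count-mono-< (earlierInPart? u) (earlierInPart? w)
    (λ (x<u , px≡pu) → <ᶠ-trans x<u u<w , trans px≡pu pu≡pw) (u<w , pu≡pw) (<ᶠ-irrefl refl ∘ proj₁)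

  rank-injective : ∀ {u w} → part u ≡ part w → rank u ≡ rank w → u ≡ w
  rank-injective {u} {w} pu≡pw ru≡rw with <ᶠ-cmp u w
  ... | tri< u<w _ _ = contradiction ru≡rw (<⇒≢ (rank-mono u<w pu≡pw))
  ... | tri≈ _ u≡w _ = u≡w
  ... | tri> _ _ w<u = contradiction (sym ru≡rw) (<⇒≢ (rank-mono w<u (sym pu≡pw)))

  rankᶠ : Fin n → Fin m
  rankᶠ u = fromℕ< (rank<m u)

  embed : Fin n → Fin n
  embed u = cast (sym n≡m*r) (combine (rankᶠ u) (part u))

  embed-injective : Injective _≡_ _≡_ embed
  embed-injective {u} {w} embed≡ = rank-injective part≡ rank≡
    where
    combine≡ : combine (rankᶠ u) (part u) ≡ combine (rankᶠ w) (part w)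
    combine≡ = toℕ-injective (begin
      toℕ (combine (rankᶠ u) (part u))  ≡⟨ toℕ-cast (sym n≡m*r) _ ⟨
      toℕ (embed u)                     ≡⟨ cong toℕ embed≡ ⟩
      toℕ (embed w)                     ≡⟨ toℕ-cast (sym n≡m*r) _ ⟩
      toℕ (combine (rankᶠ w) (part w))  ∎)
      where open ≡-Reasoning
    part≡ : part u ≡ part w
    part≡ = proj₂ (combine-injective (rankᶠ u) (part u) (rankᶠ w) (part w) combine≡)
    rank≡ : rank u ≡ rank w
    rank≡ = trans (sym (toℕ-fromℕ< (rank<m u)))
      (trans (cong toℕ (proj₁ (combine-injective (rankᶠ u) (part u) (rankᶠ w) (part w) combine≡)))
        (toℕ-fromℕ< (rank<m w)))

  embed-part : ∀ u → toℕ (embed u) % r ≡ toℕ (part u)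
  embed-part u = begin
    toℕ (embed u) % r                       ≡⟨ cong (_% r) (toℕ-cast (sym n≡m*r) _) ⟩
    toℕ (combine (rankᶠ u) (part u)) % r    ≡⟨ cong (_% r) (toℕ-combine (rankᶠ u) (part u)) ⟩
    (r * toℕ (rankᶠ u) + toℕ (part u)) % r  ≡⟨ %-remove-+ˡ (toℕ (part u)) (m∣m*n (toℕ (rankᶠ u))) ⟩
    toℕ (part u) % r                        ≡⟨ m<n⇒m%n≡m (toℕ<n (part u)) ⟩
    toℕ (part u)                            ∎
    where open ≡-Reasoning

  properPartition⇒subgraphOfTurán : (G : Graph n) → (∀ {u w} → Adjacent G u w → part u ≢ part w) →
                                     IsSubgraphOf G (turanAdj n r)
  properPartition⇒subgraphOfTurán G proper = embed , embed-injective , λ u w u~w →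
    turanAdj-≢ n r λ eq → proper u~w (toℕ-injective (trans (sym (embed-part u)) (trans eq (embed-part w))))

-- Graphs with few vertices of small degree

m*n≡n+[m∸1]*n : ∀ m n .{{_ : NonZero m}} → m * n ≡ n + (m ∸ 1) * n
m*n≡n+[m∸1]*n (suc m) n = refl

module _ {n r m : ℕ} .{{_ : NonZero r}} (n≡m*r : n ≡ m * r) (G : Graph n) where

  High : Fin n → Set
  High u = (r ∸ 1) * m ≤ degree G u

  high? : Decidable High
  high? u = (r ∸ 1) * m ≤? degree G u

  r*m≡n : r * m ≡ n
  r*m≡n = trans (*-comm r m) (sym n≡m*r)

  High⇒nonNeighbours≤m : ∀ {v} → High v → count (¬? ∘ adjacent? G v) ≤ m
  High⇒nonNeighbours≤m {v} high = +-cancelʳ-≤ (degree G v) _ _ (begin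
    count (¬? ∘ adjacent? G v) + degree G v  ≡⟨ +-comm _ (degree G v) ⟩
    degree G v + count (¬? ∘ adjacent? G v)  ≡⟨ degree+nonNeighbours≡n G v ⟩
    n                                        ≡⟨ r*m≡n ⟨
    r * m                                    ≡⟨ m*n≡n+[m∸1]*n r m ⟩
    m + (r ∸ 1) * m                          ≤⟨ +-monoʳ-≤ m high ⟩
    m + degree G v                           ∎)
    where open ≤-Reasoning

  nonAdjacent? : (v : Fin j → Fin n) (u : Fin n) → Decidable (λ a → ¬ Adjacent G (v a) u)
  nonAdjacent? v u a = ¬? (adjacent? G (v a) u)

  nonAdjacentCount : (Fin j → Fin n) → Fin n → ℕ
  nonAdjacentCount v u = count (nonAdjacent? v u)

  ∑-nonAdjacentCount≤ : (v : Fin j → Fin n) → (∀ a → High (v a)) → sum (nonAdjacentCount v) ≤ j * m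
  ∑-nonAdjacentCount≤ {j} v high = begin
    sum (nonAdjacentCount v)                    ≡⟨ ∑-comm (λ u a → 𝟙 (does (nonAdjacent? v u a))) ⟩
    sum (λ a → count (¬? ∘ adjacent? G (v a)))  ≤⟨ ∑-mono-≤ (High⇒nonNeighbours≤m ∘ high) ⟩
    sum {j} (const m)                           ≡⟨ ∑-const j m ⟩
    j * m                                       ∎
    where open ≤-Reasoning

  module _ (few¬High : count (¬? ∘ high?) < m) where

    commonHighNeighbour : (v : Fin j → Fin n) → (∀ a → High (v a)) → j < r →
                          ∃ λ u → (∀ a → Adjacent G (v a) u) × High u
    commonHighNeighbour {j} v high j<r =
      ∑<n⇒∃ (λ u → all? (λ a → adjacent? G (v a) u) ×-dec high? u) badness bad⇒1≤badness ∑badness<n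
      where
      badness : Fin n → ℕ
      badness u = nonAdjacentCount v u + 𝟙 (does (¬? (high? u)))

      bad⇒1≤badness : ∀ u → ¬ ((∀ a → Adjacent G (v a) u) × High u) →
                      1 ≤ nonAdjacentCount v u + 𝟙 (does (¬? (high? u)))
      bad⇒1≤badness u bad with (r ∸ 1) * m ≤? degree G u
      ... | no ¬hi rewrite dec-false (high? u) ¬hi = m≤n+m 1 _
      ... | yes hi = ≤-trans (count-pos (nonAdjacent? v u) (proj₂ someNonAdjacent)) (m≤m+n _ _)
        where
        someNonAdjacent : ∃ λ a → ¬ Adjacent G (v a) u
        someNonAdjacent = ¬∀⟶∃¬ j _ (λ a → adjacent? G (v a) u) (λ v~u → bad (v~u , hi))

      ∑badness<n : sum badness < n
      ∑badness<n = begin-strict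
        sum badness                                    ≡⟨ ∑-distrib-+ (nonAdjacentCount v) _ ⟩
        sum (nonAdjacentCount v) + count (¬? ∘ high?)  <⟨ +-mono-≤-< (∑-nonAdjacentCount≤ v high) few¬High ⟩
        j * m + m                                      ≡⟨ +-comm (j * m) m ⟩
        suc j * m                                      ≤⟨ *-monoˡ-≤ m j<r ⟩
        r * m                                          ≡⟨ r*m≡n ⟩
        n                                              ∎
        where open ≤-Reasoning

    highClique : ∀ j → j ≤ r → Σ (Fin j → Fin n) λ v → IsClique G v × (∀ a → High (v a))
    highClique zero    _   = (λ ()) , (λ ()) , (λ ())
    highClique (suc j) j<r with highClique j (<⇒≤ j<r)
    ... | v , clique , high with commonHighNeighbour v high j<r
    ... | u , v~u , highU =
      u Vector.∷ v , ∷-clique G clique v~u , λ { zero → highU ; (suc a) → high a }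

  module _ (K-free : ¬ ContainsK (suc r) G) {v : Fin r → Fin n} (clique : IsClique G v)
           (high : ∀ a → High (v a)) where

    someNonAdjacent : ∀ u → ∃ λ a → ¬ Adjacent G (v a) u
    someNonAdjacent u = ¬∀⟶∃¬ r _ (λ a → adjacent? G (v a) u)
      (λ v~u → K-free (clique⇒ContainsK G (∷-clique G clique v~u)))

    part : Fin n → Fin r
    part u = proj₁ (someNonAdjacent u)

    part-nonAdjacent : ∀ u → ¬ Adjacent G (v (part u)) u
    part-nonAdjacent u = proj₂ (someNonAdjacent u)

    nonAdjacentCount≤1 : ∀ u → nonAdjacentCount v u ≤ 1
    nonAdjacentCount≤1 = ∑≤n⇒≤1 (nonAdjacentCount v)
      (λ u → count-pos (nonAdjacent? v u) (part-nonAdjacent u))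
      (≤-trans (∑-nonAdjacentCount≤ v high) (≤-reflexive r*m≡n))

    ≢part⇒adjacent : ∀ {b u} → b ≢ part u → Adjacent G (v b) u
    ≢part⇒adjacent {b} {u} b≢pu with adjacent? G (v b) u
    ... | yes b~u = b~u
    ... | no ¬b~u = contradiction
      (count≤1⇒unique (nonAdjacent? v u) (nonAdjacentCount≤1 u) ¬b~u (part-nonAdjacent u)) b≢pu

    part-proper : ∀ {u w} → Adjacent G u w → part u ≢ part w
    part-proper {u} {w} u~w pu≡pw = K-free (clique⇒ContainsK G (∷-clique G swapped-clique swapped~u))
      where
      others~w : ∀ b → b ≢ part u → Adjacent G (v b) w
      others~w b b≢pu = ≢part⇒adjacent (b≢pu ∘ (λ b≡pw → trans b≡pw (sym pu≡pw)))
      swapped-clique : IsClique G (updateAt v (part u) (const w))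
      swapped-clique = updateAt-clique G clique others~w
      swapped~u : ∀ b → Adjacent G (updateAt v (part u) (const w) b) u
      swapped~u = updateAt-const-∀ {P = λ x → Adjacent G x u} v (part u) (Adjacent-sym G u~w)
                                   (λ _ → ≢part⇒adjacent)

    partSize≤m : ∀ c → count (λ u → part u ≟ᶠ c) ≤ m
    partSize≤m c = ≤-trans
      (count-mono (λ u → part u ≟ᶠ c) (¬? ∘ adjacent? G (v c)) (λ { {u} refl → part-nonAdjacent u }))
      (High⇒nonNeighbours≤m (high c))

  K-free⇒subgraphOfTurán : count (¬? ∘ high?) < m → ¬ ContainsK (suc r) G →
                           IsSubgraphOf G (turanAdj n r)
  K-free⇒subgraphOfTurán few¬High K-free =
    let v , clique , high = highClique few¬High r ≤-refl
    in  properPartition⇒subgraphOfTurán n≡m*r (part K-free clique high) (partSize≤m K-free clique high)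
          G (part-proper K-free clique high)

theorem1p10 : (n r : ℕ) → .{{_ : NonZero r}} → r ≤ n → r ∣ n →
    (G : Graph n) → ¬ ContainsK (suc r) G →
    (r ∸ 1) * n / r ≤ nth (n / r) (degreeSeq G) →
    IsSubgraphOf G (turanAdj n r)
theorem1p10 n r r≤n r∣n G K-free d[n/r]≥ = K-free⇒subgraphOfTurán n≡m*r G few¬High K-free
  where
  m = n / r
  n≡m*r : n ≡ m * r
  n≡m*r = sym (m/n*n≡m r∣n)
  d[m]≥ : (r ∸ 1) * m ≤ nth m (degreeSeq G)
  d[m]≥ = subst (_≤ nth m (degreeSeq G)) (*-/-assoc (r ∸ 1) r∣n) d[n/r]≥
  few¬High : count (¬? ∘ high? n≡m*r G) < m
  few¬High = subst (_< m) (sym (countBelow-degreeSeq G ((r ∸ 1) * m)))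
    (countBelow-sorted (sort-↗ _) d[m]≥ (m≥n⇒m/n>0 r≤n))
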